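{- Let $c,k$ be positive integers, $G$ a graph, and $X$ the set of vertices of $G$ that belong to at least one bad pair. Call a bad pair heavy if it has more than $k+c$ common neighbors in $V(G)\setminus X$, and weak otherwise. Mark all vertices of $X$ and all vertices that are common neighbors of at least one weak bad pair. Let $w$ be any unmarked vertex and $G'=G-\{w\}$. Then $(G,k)$ is a yes-instance of \textsc{$c$-Closed Vertex Deletion} if and only if $(G',k)$ is a yes-instance of \textsc{$c$-Closed Vertex Deletion}.
   Context: A graph is $c$-closed if every pair of distinct nonadjacent vertices has at most $c-1$ common neighbors. A bad pair is a pair of distinct nonadjacent vertices with at least $c$ common neighbors. \textsc{$c$-Closed Vertex Deletion}: given a graph $G=(V,E)$ and a positive integer $k$, decide whether there is $S\subseteq V$ with $|S|\le k$ such that $G-S$ is $c$-closed. -}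

module Defs where

open import Data.Nat using (ℕ; _≤_; _<_; _+_)
open import Data.Bool using (Bool; true; false)
open import Data.Fin using (Fin)
open import Data.Fin.Subset using (Subset; _∈_; _⊆_; _∩_; _─_; ∣_∣)
open import Data.Vec using (tabulate)
open import Data.Product using (Σ; ∃; ∃₂; _×_)
open import Relation.Binary.PropositionalEquality using (_≡_; _≢_)

record Graph (n : ℕ) : Set where
  field
    adj   : Fin n → Fin n → Bool
    sym   : ∀ u v → adj u v ≡ adj v u
    loopless : ∀ u → adj u u ≡ false
open Graph public

module _ {n : ℕ} (G : Graph n) where

  N : Fin n → Subset n
  N u = tabulate (adj G u)

  commonIn : Subset n → Fin n → Fin n → Subset n
  commonIn W u v = W ∩ N u ∩ N v

  -- Induced subgraphs are represented by their vertex set U ⊆ Fin n.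
  -- A bad pair of G[U]: distinct nonadjacent u,v ∈ U with ≥ c common
  -- neighbours in U.
  BadPairIn : Subset n → ℕ → Fin n → Fin n → Set
  BadPairIn U c u v =
    u ∈ U × v ∈ U × u ≢ v × adj G u v ≡ false × c ≤ ∣ commonIn U u v ∣

  CClosedIn : Subset n → ℕ → Set
  CClosedIn U c = ∀ u v → u ∈ U → v ∈ U → u ≢ v → adj G u v ≡ false →
                  ∣ commonIn U u v ∣ < c

  YesInstanceIn : Subset n → ℕ → ℕ → Set
  YesInstanceIn U c k = Σ (Subset n) λ S → S ⊆ U × ∣ S ∣ ≤ k × CClosedIn (U ─ S) c

-- Solutions restrict to induced subgraphs, so deleting w keeps a yes-instance.
-- Conversely, let S solve G - w and suppose u, v were a bad pair of G - S.
-- Then u, v ∈ X, so neither is w. If w is not a common neighbour of u and v,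
-- their common neighbours in G - S and in G - w - S coincide, contradicting the
-- choice of S. If it is, the pair is heavy because w is unmarked; but each of
-- its common neighbours outside X lies in G - w - S (fewer than c of them),
-- in S (at most k) or is w itself, so there are at most k + c of them.
module Submission where

open import Defs
open import Data.Nat using (ℕ; _≤_; _<_; _+_; suc; z≤n; s≤s)
open import Data.Nat.Properties
  using ( module ≤-Reasoning; ≤-trans; ≤-<-trans; <⇒≱; n≤1+n; +-mono-≤; +-monoʳ-≤; +-suc; +-comm
        ; _<?_; ≮⇒≥; ≰⇒>)
open import Data.Fin using (Fin)
open import Data.Fin.Subset
  using (Subset; _∈_; _∉_; _⊆_; ⊤; ∁; _∩_; _∪_; _─_; _-_; ⁅_⁆; ∣_∣; inside; outside)
open import Data.Fin.Subset.Properties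
  using ( _∈?_; ∈⊤; x∈p∩q⁺; x∈p∩q⁻; ∩-comm; p⊆q⇒∣p∣≤∣q∣; p─q⊆p; p∩q⊆p; ∣p∩q∣≤∣q∣
        ; x∈p∧x∉q⇒x∈p─q; p─q─r≡p─q∪r; x∈p∪q⁺; ∣⁅x⁆∣≡1; x∈p∧x≢y⇒x∈p-y)
open import Data.Vec using ([]; _∷_; here; there)
open import Data.Product using (∃; ∃₂; _×_; _,_; proj₁; proj₂)
open import Data.Sum using (inj₁; inj₂)
open import Data.Empty using (⊥-elim)
open import Function using (_∘_)
open import Function.Bundles using (_⇔_; mk⇔; Equivalence)
open import Relation.Nullary using (¬_; yes; no)
open import Relation.Binary.PropositionalEquality as ≡ using (_≡_; _≢_; refl; cong; subst)

x∈p─q⇒x∉q : ∀ {n} (p q : Subset n) {x} → x ∈ p ─ q → x ∉ q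
x∈p─q⇒x∉q (_ ∷ p) (outside ∷ q) here      ()
x∈p─q⇒x∉q (_ ∷ p) (_ ∷ q)       (there x∈) (there x∈q) = x∈p─q⇒x∉q p q x∈ x∈q

x∉⊤─p⇒x∈p : ∀ {n} (p : Subset n) {x} → x ∉ ⊤ ─ p → x ∈ p
x∉⊤─p⇒x∈p p {x} x∉ with x ∈? p
... | yes x∈p = x∈p
... | no  x∉p = ⊥-elim (x∉ (x∈p∧x∉q⇒x∈p─q ∈⊤ x∉p))

∣p∪q∣≤∣p∣+∣q∣ : ∀ {n} (p q : Subset n) → ∣ p ∪ q ∣ ≤ ∣ p ∣ + ∣ q ∣
∣p∪q∣≤∣p∣+∣q∣ []            []            = z≤n
∣p∪q∣≤∣p∣+∣q∣ (outside ∷ p) (outside ∷ q) = ∣p∪q∣≤∣p∣+∣q∣ p q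
∣p∪q∣≤∣p∣+∣q∣ (outside ∷ p) (inside  ∷ q) =
  subst (suc ∣ p ∪ q ∣ ≤_) (≡.sym (+-suc ∣ p ∣ ∣ q ∣)) (s≤s (∣p∪q∣≤∣p∣+∣q∣ p q))
∣p∪q∣≤∣p∣+∣q∣ (inside  ∷ p) (outside ∷ q) = s≤s (∣p∪q∣≤∣p∣+∣q∣ p q)
∣p∪q∣≤∣p∣+∣q∣ (inside  ∷ p) (inside  ∷ q) =
  s≤s (≤-trans (∣p∪q∣≤∣p∣+∣q∣ p q) (+-monoʳ-≤ ∣ p ∣ (n≤1+n ∣ q ∣)))

x∈p─[⊤-y─q]⇒x∈⁅y⁆∪q : ∀ {n} (p q : Subset n) (y : Fin n) {x} → x ∈ p ─ (⊤ - y ─ q) → x ∈ ⁅ y ⁆ ∪ q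
x∈p─[⊤-y─q]⇒x∈⁅y⁆∪q p q y x∈ rewrite p─q─r≡p─q∪r ⊤ ⁅ y ⁆ q =
  x∉⊤─p⇒x∈p (⁅ y ⁆ ∪ q) (x∈p─q⇒x∉q p _ x∈)

∣p─[⊤-y─q]∣≤1+∣q∣ : ∀ {n} (p q : Subset n) (y : Fin n) → ∣ p ─ (⊤ - y ─ q) ∣ ≤ suc ∣ q ∣
∣p─[⊤-y─q]∣≤1+∣q∣ p q y = begin
  ∣ p ─ (⊤ - y ─ q) ∣  ≤⟨ p⊆q⇒∣p∣≤∣q∣ (x∈p─[⊤-y─q]⇒x∈⁅y⁆∪q p q y) ⟩
  ∣ ⁅ y ⁆ ∪ q ∣        ≤⟨ ∣p∪q∣≤∣p∣+∣q∣ ⁅ y ⁆ q ⟩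
  ∣ ⁅ y ⁆ ∣ + ∣ q ∣    ≡⟨ cong (_+ ∣ q ∣) (∣⁅x⁆∣≡1 y) ⟩
  suc ∣ q ∣            ∎
  where open ≤-Reasoning

module _ {n : ℕ} (G : Graph n) where

  commonIn-move : ∀ {A B u v x} → x ∈ commonIn G A u v → x ∈ B → x ∈ commonIn G B u v
  commonIn-move {A} x∈ x∈B = x∈p∩q⁺ (x∈B , proj₂ (x∈p∩q⁻ A _ x∈))

  commonIn-mono : ∀ {A B} u v → A ⊆ B → commonIn G A u v ⊆ commonIn G B u v
  commonIn-mono {A} u v A⊆B x∈ = commonIn-move x∈ (A⊆B (proj₁ (x∈p∩q⁻ A _ x∈)))

  commonIn-comm : ∀ A u v → commonIn G A u v ≡ commonIn G A v u
  commonIn-comm A u v = cong (A ∩_) (∩-comm (N G u) (N G v))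

  commonIn⊆commonIn∪─ : ∀ A B u v → commonIn G A u v ⊆ commonIn G B u v ∪ (A ─ B)
  commonIn⊆commonIn∪─ A B u v {x} x∈ with x ∈? B
  ... | yes x∈B = x∈p∪q⁺ (inj₁ (commonIn-move x∈ x∈B))
  ... | no  x∉B = x∈p∪q⁺ (inj₂ (x∈p∧x∉q⇒x∈p─q (proj₁ (x∈p∩q⁻ A _ x∈)) x∉B))

  ∣commonIn∣≤∣commonIn∣+∣─∣ : ∀ A B u v → ∣ commonIn G A u v ∣ ≤ ∣ commonIn G B u v ∣ + ∣ A ─ B ∣
  ∣commonIn∣≤∣commonIn∣+∣─∣ A B u v =
    ≤-trans (p⊆q⇒∣p∣≤∣q∣ (commonIn⊆commonIn∪─ A B u v)) (∣p∪q∣≤∣p∣+∣q∣ (commonIn G B u v) (A ─ B))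

  BadPairIn-mono : ∀ {A B c u v} → A ⊆ B → BadPairIn G A c u v → BadPairIn G B c u v
  BadPairIn-mono {u = u} {v} A⊆B (u∈ , v∈ , u≢v , u≁v , c≤) =
    A⊆B u∈ , A⊆B v∈ , u≢v , u≁v , ≤-trans c≤ (p⊆q⇒∣p∣≤∣q∣ (commonIn-mono u v A⊆B))

  BadPairIn-sym : ∀ {A c u v} → BadPairIn G A c u v → BadPairIn G A c v u
  BadPairIn-sym {A} {c} {u} {v} (u∈ , v∈ , u≢v , u≁v , c≤) =
    v∈ , u∈ , u≢v ∘ ≡.sym , ≡.trans (Graph.sym G v u) u≁v ,
    subst (λ C → c ≤ ∣ C ∣) (commonIn-comm A u v) c≤

  CClosedIn-antitone : ∀ {A B} c → A ⊆ B → CClosedIn G B c → CClosedIn G A c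
  CClosedIn-antitone c A⊆B closed u v u∈ v∈ u≢v u≁v =
    ≤-<-trans (p⊆q⇒∣p∣≤∣q∣ (commonIn-mono u v A⊆B)) (closed u v (A⊆B u∈) (A⊆B v∈) u≢v u≁v)

  ¬BadPairIn⇒CClosedIn : ∀ {U c} → (∀ u v → ¬ BadPairIn G U c u v) → CClosedIn G U c
  ¬BadPairIn⇒CClosedIn {U} {c} no-bad u v u∈ v∈ u≢v u≁v with ∣ commonIn G U u v ∣ <? c
  ... | yes few = few
  ... | no  ¬few = ⊥-elim (no-bad u v (u∈ , v∈ , u≢v , u≁v , ≮⇒≥ ¬few))

  YesInstanceIn-antitone : ∀ {A B} c k → A ⊆ B → YesInstanceIn G B c k → YesInstanceIn G A c k
  YesInstanceIn-antitone {A} {B} c k A⊆B (S , _ , ∣S∣≤k , closed) =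
    A ∩ S , p∩q⊆p A S , ≤-trans (∣p∩q∣≤∣q∣ A S) ∣S∣≤k , CClosedIn-antitone c A─S⊆B─S closed
    where
    A─S⊆B─S : A ─ (A ∩ S) ⊆ B ─ S
    A─S⊆B─S x∈ = x∈p∧x∉q⇒x∈p─q (A⊆B x∈A) (x∈p─q⇒x∉q A (A ∩ S) x∈ ∘ x∈p∩q⁺ ∘ (x∈A ,_))
      where x∈A = p─q⊆p A (A ∩ S) x∈

module _ {n : ℕ} (G : Graph n) {c k : ℕ} {X : Subset n}
         (bad⇒∈X : ∀ {x y} → BadPairIn G ⊤ c x y → x ∈ X)
         {w : Fin n} (w∉X : w ∉ X)
         (heavy : ∀ {u v} → BadPairIn G ⊤ c u v → w ∈ commonIn G ⊤ u v →
                  k + c < ∣ commonIn G (∁ X) u v ∣)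
  where

  BadPairIn-avoids : ∀ {u v} → BadPairIn G ⊤ c u v → u ≢ w
  BadPairIn-avoids bad refl = w∉X (bad⇒∈X bad)

  CClosedIn-restore : ∀ S → ∣ S ∣ ≤ k → CClosedIn G (⊤ - w ─ S) c → CClosedIn G (⊤ ─ S) c
  CClosedIn-restore S ∣S∣≤k closed = ¬BadPairIn⇒CClosedIn G no-bad
    where
    U = ⊤ - w ─ S

    ∈U : ∀ {x} → x ∈ ⊤ ─ S → x ≢ w → x ∈ U
    ∈U x∈ x≢w = x∈p∧x∉q⇒x∈p─q (x∈p∧x≢y⇒x∈p-y ∈⊤ x≢w) (x∈p─q⇒x∉q ⊤ S x∈)

    bad⊤ : ∀ {u v} → BadPairIn G (⊤ ─ S) c u v → BadPairIn G ⊤ c u v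
    bad⊤ = BadPairIn-mono G (p─q⊆p ⊤ S)

    few : ∀ {u v} → BadPairIn G (⊤ ─ S) c u v → ∣ commonIn G U u v ∣ < c
    few {u} {v} bad@(u∈ , v∈ , u≢v , u≁v , _) =
      closed u v (∈U u∈ (BadPairIn-avoids (bad⊤ bad)))
                 (∈U v∈ (BadPairIn-avoids (BadPairIn-sym G (bad⊤ bad)))) u≢v u≁v

    common⊆ : ∀ {u v} → w ∉ commonIn G ⊤ u v → commonIn G (⊤ ─ S) u v ⊆ commonIn G U u v
    common⊆ {u} {v} w∉ x∈ = commonIn-move G x∈ (∈U (proj₁ (x∈p∩q⁻ (⊤ ─ S) _ x∈))
                              λ { refl → w∉ (commonIn-mono G u v (λ _ → ∈⊤) x∈) })

    weak : ∀ {u v} → BadPairIn G (⊤ ─ S) c u v → ∣ commonIn G (∁ X) u v ∣ ≤ k + c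
    weak {u} {v} bad = begin
      ∣ commonIn G (∁ X) u v ∣                 ≤⟨ ∣commonIn∣≤∣commonIn∣+∣─∣ G (∁ X) U u v ⟩
      ∣ commonIn G U u v ∣ + ∣ ∁ X ─ U ∣       ≤⟨ +-monoʳ-≤ _ (∣p─[⊤-y─q]∣≤1+∣q∣ (∁ X) S w) ⟩
      ∣ commonIn G U u v ∣ + suc ∣ S ∣         ≡⟨ +-suc _ ∣ S ∣ ⟩
      suc ∣ commonIn G U u v ∣ + ∣ S ∣         ≤⟨ +-mono-≤ (few bad) ∣S∣≤k ⟩
      c + k                                    ≡⟨ +-comm c k ⟩
      k + c                                    ∎
      where open ≤-Reasoning

    no-bad : ∀ u v → ¬ BadPairIn G (⊤ ─ S) c u v
    no-bad u v bad@(_ , _ , _ , _ , c≤) with w ∈? commonIn G ⊤ u v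
    ... | no  w∉ = <⇒≱ (few bad) (≤-trans c≤ (p⊆q⇒∣p∣≤∣q∣ (common⊆ w∉)))
    ... | yes w∈ = <⇒≱ (heavy (bad⊤ bad) w∈) (weak bad)

lemma5 : (n : ℕ) (G : Graph n) (c k : ℕ) → 1 ≤ c → 1 ≤ k →
    (X : Subset n) →
    (∀ x → x ∈ X ⇔ ∃ λ y → BadPairIn G ⊤ c x y) →
    (w : Fin n) →
    w ∉ X →
    ¬ (∃₂ λ u v → BadPairIn G ⊤ c u v
                  × ∣ commonIn G (∁ X) u v ∣ ≤ k + c
                  × w ∈ commonIn G ⊤ u v) →
    YesInstanceIn G ⊤ c k ⇔ YesInstanceIn G (⊤ - w) c k
lemma5 n G c k _ _ X X-bad w w∉X unmarked = mk⇔ delete insert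
  where
  delete : YesInstanceIn G ⊤ c k → YesInstanceIn G (⊤ - w) c k
  delete = YesInstanceIn-antitone G c k (p─q⊆p ⊤ ⁅ w ⁆)

  heavy : ∀ {u v} → BadPairIn G ⊤ c u v → w ∈ commonIn G ⊤ u v →
          k + c < ∣ commonIn G (∁ X) u v ∣
  heavy {u} {v} bad w∈ = ≰⇒> λ weak → unmarked (u , v , bad , weak , w∈)

  insert : YesInstanceIn G (⊤ - w) c k → YesInstanceIn G ⊤ c k
  insert (S , _ , ∣S∣≤k , closed) =
    S , (λ _ → ∈⊤) , ∣S∣≤k ,
    CClosedIn-restore G (λ bad → Equivalence.from (X-bad _) (_ , bad)) w∉X heavy S ∣S∣≤k closed
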